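{- Let $G$ be a finite connected bridgeless graph with $\operatorname{cdim}(G)\ge2$. For every cycle segment $H$ of $G$, the graph $G-H$ is bridgeless.
   Context: Graphs are finite, $G=(V,E,r)$, loops and multiple edges allowed. A cycle is a closed walk of length $\ge1$ with no repeated edge and no repeated vertex except first=last, identified with its body; $\mathrm{Cycle}(G)$ is the set of cycle bodies. A sign labeling is $f:\mathrm{Cycle}(G)\times E\to\{ -1,0,1\}$ with $f(C,e)=0$ iff $e\notin C$; $\operatorname{cdim}(G)=\min_f\dim\operatorname{span}\{f(C):C\in\mathrm{Cycle}(G)\}\subseteq\mathbb R^E$. A cycle segment is a subgraph $H$ of $G$ maximal under inclusion among subgraphs $K$ such that every cycle body having a common edge with $K$ contains $K$. For a subgraph $\bar G$, $G-\bar G$ has edge set $E\setminus\bar E$ and vertex set consisting of the vertices of $G$ not in $\bar G$ together with all endpoints of edges in $E\setminus\bar E$. A graph is bridgeless if no edge's removal increases the number of connected components. -}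

module Defs where

open import Data.Nat using (ℕ; zero; suc; _≥_)
open import Data.Fin using (Fin; inject₁; fromℕ) renaming (zero to fzero; suc to fsuc)
open import Data.Fin.Subset using (Subset; ⊤; _∈_; _∉_; _⊆_; ∁; _∩_; _─_; ⁅_⁆)
open import Data.Product using (Σ; ∃; ∃-syntax; _×_; _,_; proj₁; proj₂)
open import Data.Sum using (_⊎_)
open import Data.Integer using (ℤ; +_; -[1+_]; _+_; _*_)
open import Function using (_⇔_)
open import Data.Unit using () renaming (⊤ to Unit)
open import Function.Definitions using (Injective)
open import Relation.Binary.PropositionalEquality using (_≡_)
open import Relation.Nullary using (¬_)

-- Finite graphs with loops and multiple edges.
-- Vertices are Fin n, edges are Fin m, and every edge has an unordered
-- pair of endpoints given by  ends e  (the order of the pair is irrelevant).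

record Graph : Set where
  field
    n    : ℕ
    m    : ℕ
    ends : Fin m → Fin n × Fin n

module _ (G : Graph) where
  open Graph G

  Joins : Fin m → Fin n → Fin n → Set
  Joins e x y = (ends e ≡ (x , y)) ⊎ (ends e ≡ (y , x))

  EndOf : Fin n → Fin m → Set
  EndOf v e = (proj₁ (ends e) ≡ v) ⊎ (proj₂ (ends e) ≡ v)

  record Subgraph : Set where
    constructor sub
    field
      verts : Subset n
      edges : Subset m
      closed : ∀ e v → e ∈ edges → EndOf v e → v ∈ verts

  open Subgraph public

  _⊑_ : Subgraph → Subgraph → Set
  K ⊑ L = (verts K ⊆ verts L) × (edges K ⊆ edges L)

  record Cycle : Set where
    field
      len      : ℕ
      len≥1    : len ≥ 1
      vert     : Fin (suc len) → Fin n
      edge     : Fin len → Fin m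
      incident : ∀ i → Joins (edge i) (vert (inject₁ i)) (vert (fsuc i))
      isClosed : vert fzero ≡ vert (fromℕ len)
      edgeInj  : Injective _≡_ _≡_ edge
      vertInj  : Injective _≡_ _≡_ (λ (i : Fin len) → vert (inject₁ i))

  IsBodyOf : Subgraph → Cycle → Set
  IsBodyOf C W =
    (∀ v → v ∈ verts C ⇔ (∃[ i ] Cycle.vert W i ≡ v)) ×
    (∀ e → e ∈ edges C ⇔ (∃[ i ] Cycle.edge W i ≡ e))

  IsCycleBody : Subgraph → Set
  IsCycleBody C = ∃[ W ] IsBodyOf C W

  -- Sign labeling f : Cycle(G) × E → {-1,0,1} with f(C,e) = 0 iff e ∉ C.
  -- (Values of f on subgraphs that are not cycle bodies are irrelevant.)
  IsSign : ℤ → Set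
  IsSign z = (z ≡ -[1+ 0 ]) ⊎ (z ≡ + 0) ⊎ (z ≡ + 1)

  IsSignLabeling : (Subgraph → Fin m → ℤ) → Set
  IsSignLabeling f = ∀ C → IsCycleBody C → ∀ e →
    IsSign (f C e) × (f C e ≡ + 0 ⇔ e ∉ edges C)

  -- Linear independence of two vectors in ℤ^E (equivalently over ℝ,
  -- since the vectors have integer entries).
  LinIndep₂ : (Fin m → ℤ) → (Fin m → ℤ) → Set
  LinIndep₂ u v = ∀ (a b : ℤ) → (∀ e → a * u e + b * v e ≡ + 0) → (a ≡ + 0) × (b ≡ + 0)

  SpanDim≥2 : (Subgraph → Fin m → ℤ) → Set
  SpanDim≥2 f = ∃[ C ] ∃[ D ] IsCycleBody C × IsCycleBody D × LinIndep₂ (f C) (f D)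

  CDim≥2 : Set
  CDim≥2 = ∀ f → IsSignLabeling f → SpanDim≥2 f

  SegProp : Subgraph → Set
  SegProp K = ∀ C → IsCycleBody C → (∃[ e ] e ∈ edges K × e ∈ edges C) → K ⊑ C

  IsCycleSegment : Subgraph → Set
  IsCycleSegment H = SegProp H × (∀ K → SegProp K → H ⊑ K → K ⊑ H)

  data Conn (Es : Subset m) : Fin n → Fin n → Set where
    here : ∀ {x} → Conn Es x x
    step : ∀ {x y z} e → e ∈ Es → Joins e x y → Conn Es y z → Conn Es x z

  -- The graph with vertex set VP and edge set Es (with endpoints of Es in VP)
  -- is bridgeless: removing any edge does not increase the number of connected
  -- components, i.e. any two vertices connected before are still connected.
  BridgelessOn : (Fin n → Set) → Subset m → Set
  BridgelessOn VP Es = ∀ e → e ∈ Es → ∀ x y → VP x → VP y →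
    Conn Es x y → Conn (Es ─ ⁅ e ⁆) x y

  Connected : Set
  Connected = ∀ x y → Conn ⊤ x y

  Bridgeless : Set
  Bridgeless = BridgelessOn (λ _ → Unit) ⊤

  MinusEdges : Subgraph → Subset m
  MinusEdges H = ∁ (edges H)

  MinusVerts : Subgraph → Fin n → Set
  MinusVerts H v = (v ∉ verts H) ⊎ (∃[ e ] e ∈ ∁ (edges H) × EndOf v e)

  BridgelessMinus : Subgraph → Set
  BridgelessMinus H = BridgelessOn (MinusVerts H) (MinusEdges H)

-- If the ends u, v of an edge e of G − H were disconnected in G − H − e, the
-- vertices reachable from u in G − H − e would form a cut that no edge outside
-- H other than e crosses. A cycle crosses every cut an even number of times, so
-- a cycle contains e exactly when it crosses this cut an odd number of times
-- inside H. Hence a cycle through e meets H and therefore contains it, and,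
-- comparing with one cycle through e (there is one since G is bridgeless),
-- every cycle containing H contains e. Then H + e also has the segment
-- property, contradicting the maximality of H. So u and v are connected in
-- G − H − e, and every walk in G − H can be rerouted around e.

module Submission where

open import Algebra.Bundles using (CommutativeRing)
open import Data.Bool using (Bool; true; false; _∧_; _xor_)
open import Data.Bool.Properties
  using (∧-zeroʳ; xor-∧-commutativeRing; xor-same; xor-comm; xor-identityʳ; not-involutive)
open import Data.Empty using (⊥; ⊥-elim)
open import Data.Fin using (Fin; zero; suc; inject₁; fromℕ; _≟_)
open import Data.Fin.Properties
  using (any?; suc-injective; 0≢1+n; injective⇒≤; fromℕ≢inject₁; inject₁-injective)
open import Data.Fin.Subset using (Subset; inside; outside; ⊤; _∈_; _∉_; ∁; _∪_; _─_; ⁅_⁆)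
open import Data.Fin.Subset.Properties
  using (_∈?_; ∈⊤; x∈⁅x⁆; x∈⁅y⁆⇒x≡y; x∈p∪q⁺; x∈p∪q⁻; x∈p∧x≢y⇒x∈p-y; x∉p⇒x∈∁p; x∈∁p⇒x∉p)
open import Data.Nat using (ℕ; zero; suc; z≤n; s≤s; _<_; _≤_)
open import Data.Nat.Properties using (<⇒≤)
open import Data.Product using (Σ; ∃; ∃-syntax; _×_; _,_; proj₁; proj₂)
open import Data.Product.Properties using (≡-dec)
open import Data.Sum using (_⊎_; inj₁; inj₂; [_,_]′)
open import Data.Unit using (tt)
open import Data.Vec using (tabulate; _∷_; here; there)
open import Data.Vec.Properties using (lookup∘tabulate; lookup⇒[]=; []=⇒lookup)
open import Function using (_∘_)
open import Function.Bundles using (_⇔_; mk⇔; Equivalence)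
open import Function.Definitions using (Injective)
open import Relation.Binary.PropositionalEquality
open import Relation.Nullary using (Dec; does; yes; no; ¬_)
open import Relation.Nullary.Decidable using (dec-true; dec-false; does-⇔; map′; _×-dec_; _⊎-dec_)

open import Defs

-- Sums are taken in F₂ = (Bool, xor, ∧), so they compute parities.
open import Algebra.Properties.Semiring.Sum (CommutativeRing.semiring xor-∧-commutativeRing)
  using (sum; sum-syntax; ∑-comm; ∑-distrib-+; *-distribʳ-sum; sum-cong-≗; sum-replicate-zero)

infix 7 _∈ᵇ_
_∈ᵇ_ : ∀ {k} → Fin k → Subset k → Bool
x ∈ᵇ p = does (x ∈? p)

∈ᵇ⇒∈ : ∀ {k} {x : Fin k} {p : Subset k} → x ∈ᵇ p ≡ true → x ∈ p
∈ᵇ⇒∈ {x = x} {p} x∈ᵇp with x ∈? p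
... | yes x∈p = x∈p

tabulate-∈⁺ : ∀ {k} {P : Fin k → Set} (P? : ∀ x → Dec (P x)) {x} → P x → x ∈ tabulate (does ∘ P?)
tabulate-∈⁺ P? {x} px = lookup⇒[]= x _ (trans (lookup∘tabulate _ x) (dec-true (P? x) px))

tabulate-∈⁻ : ∀ {k} {P : Fin k → Set} (P? : ∀ x → Dec (P x)) {x} → x ∈ tabulate (does ∘ P?) → P x
tabulate-∈⁻ P? {x} x∈ with P? x | trans (sym (lookup∘tabulate (does ∘ P?) x)) ([]=⇒lookup x∈)
... | yes px | _ = px
... | no _ | ()

x∈p─q⇒x∉q : ∀ {k} {x : Fin k} (p q : Subset k) → x ∈ p ─ q → x ∉ q
x∈p─q⇒x∉q (inside ∷ p) (outside ∷ q) here ()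
x∈p─q⇒x∉q (_ ∷ p) (_ ∷ q) (there x∈p─q) (there x∈q) = x∈p─q⇒x∉q p q x∈p─q x∈q

xor≡false⇒≡ : ∀ {a b} → a xor b ≡ false → a ≡ b
xor≡false⇒≡ {false} {false} _ = refl
xor≡false⇒≡ {true}  {true}  _ = refl

∑-δ : ∀ {k} (a : Fin k) (g : Fin k → Bool) → ∑[ i < k ] (does (a ≟ i) ∧ g i) ≡ g a
∑-δ {suc k} zero g = trans (cong (g zero xor_) (sum-replicate-zero k)) (xor-identityʳ (g zero))
∑-δ {suc k} (suc a) g = ∑-δ a (g ∘ suc)

∑-telescope : ∀ {k} (t : Fin (suc k) → Bool) →
  ∑[ i < k ] (t (inject₁ i) xor t (suc i)) ≡ t zero xor t (fromℕ k)
∑-telescope {zero} t = sym (xor-same (t zero))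
∑-telescope {suc k} t =
  trans (cong ((t zero xor t (suc zero)) xor_) (∑-telescope (t ∘ suc)))
        (xor-cancel-middle (t zero) (t (suc zero)) (t (fromℕ (suc k))))
  where
  xor-cancel-middle : ∀ a b c → (a xor b) xor (b xor c) ≡ a xor c
  xor-cancel-middle false false c = refl
  xor-cancel-middle false true  c = not-involutive c
  xor-cancel-middle true  false c = refl
  xor-cancel-middle true  true  c = refl

∑-preimage : ∀ {k M} {h : Fin k → Fin M} → Injective _≡_ _≡_ h →
  ∀ f → ∑[ i < k ] does (h i ≟ f) ≡ does (any? λ i → h i ≟ f)
∑-preimage {zero} _ f = refl
∑-preimage {suc k} {h = h} h-injective f
  with h zero ≟ f | ∑-preimage {h = h ∘ suc} (λ eq → suc-injective (h-injective eq)) f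
... | yes refl | ih = cong (true xor_)
  (trans ih (dec-false (any? λ i → h (suc i) ≟ f) λ (_ , eq) → 0≢1+n (h-injective (sym eq))))
... | no _     | ih = ih

∑-image : ∀ {k M} {h : Fin k → Fin M} → Injective _≡_ _≡_ h →
  ∀ g → ∑[ f < M ] (does (any? λ i → h i ≟ f) ∧ g f) ≡ ∑[ i < k ] g (h i)
∑-image {k} {M} {h} h-injective g = begin
  ∑[ f < M ] (does (any? λ i → h i ≟ f) ∧ g f)
    ≡⟨ sum-cong-≗ (λ f → cong (_∧ g f) (∑-preimage h-injective f)) ⟨
  ∑[ f < M ] (∑[ i < k ] does (h i ≟ f) ∧ g f)
    ≡⟨ sum-cong-≗ (λ f → *-distribʳ-sum (g f) (λ i → does (h i ≟ f))) ⟩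
  ∑[ f < M ] ∑[ i < k ] (does (h i ≟ f) ∧ g f)
    ≡⟨ ∑-comm (λ f i → does (h i ≟ f) ∧ g f) ⟩
  ∑[ i < k ] ∑[ f < M ] (does (h i ≟ f) ∧ g f)
    ≡⟨ sum-cong-≗ (λ i → ∑-δ (h i) g) ⟩
  ∑[ i < k ] g (h i) ∎
  where open ≡-Reasoning

∑≡true⇒∃ : ∀ {k} (g : Fin k → Bool) → ∑[ i < k ] g i ≡ true → ∃ λ i → g i ≡ true
∑≡true⇒∃ {zero}  g ()
∑≡true⇒∃ {suc k} g ∑g≡true with g zero in g₀≡true
... | true  = zero , g₀≡true
... | false with ∑≡true⇒∃ (g ∘ suc) ∑g≡true
...   | i , gᵢ≡true = suc i , gᵢ≡true

module Walks (G : Graph) where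
  open Graph G

  private
    variable
      S : Subset m
      f : Fin m
      x y z a b : Fin n

  Joins-sym : Joins G f x y → Joins G f y x
  Joins-sym (inj₁ p) = inj₂ p
  Joins-sym (inj₂ p) = inj₁ p

  Joins-endpoint : Joins G f x y → Joins G f a b → x ≡ a ⊎ x ≡ b
  Joins-endpoint (inj₁ p) (inj₁ q) = inj₁ (cong proj₁ (trans (sym p) q))
  Joins-endpoint (inj₁ p) (inj₂ q) = inj₂ (cong proj₁ (trans (sym p) q))
  Joins-endpoint (inj₂ p) (inj₁ q) = inj₂ (cong proj₂ (trans (sym p) q))
  Joins-endpoint (inj₂ p) (inj₂ q) = inj₁ (cong proj₂ (trans (sym p) q))

  EndOf-Joins : EndOf G x f → Joins G f a b → x ≡ a ⊎ x ≡ b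
  EndOf-Joins (inj₁ refl) j = Joins-endpoint (inj₁ refl) j
  EndOf-Joins (inj₂ refl) j = Joins-endpoint (inj₂ refl) j

  infixr 5 _◅◅_
  _◅◅_ : Conn G S x y → Conn G S y z → Conn G S x z
  here ◅◅ w′ = w′
  step f f∈S j w ◅◅ w′ = step f f∈S j (w ◅◅ w′)

  reverse : Conn G S x y → Conn G S y x
  reverse here = here
  reverse (step f f∈S j w) = reverse w ◅◅ step f f∈S (Joins-sym j) here

  length : Conn G S x y → ℕ
  length here = 0
  length (step _ _ _ w) = suc (length w)

  vertexAt : (w : Conn G S x y) → Fin (suc (length w)) → Fin n
  vertexAt {x = x} here _ = x
  vertexAt {x = x} (step _ _ _ w) zero = x
  vertexAt (step _ _ _ w) (suc i) = vertexAt w i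

  edgeAt : (w : Conn G S x y) → Fin (length w) → Fin m
  edgeAt (step f _ _ _) zero = f
  edgeAt (step _ _ _ w) (suc i) = edgeAt w i

  edgeAt-∈ : (w : Conn G S x y) (i : Fin (length w)) → edgeAt w i ∈ S
  edgeAt-∈ (step _ f∈S _ _) zero = f∈S
  edgeAt-∈ (step _ _ _ w) (suc i) = edgeAt-∈ w i

  vertexAt-first : (w : Conn G S x y) → vertexAt w zero ≡ x
  vertexAt-first here = refl
  vertexAt-first (step _ _ _ _) = refl

  vertexAt-last : (w : Conn G S x y) → vertexAt w (fromℕ (length w)) ≡ y
  vertexAt-last here = refl
  vertexAt-last (step _ _ _ w) = vertexAt-last w

  edgeAt-joins : (w : Conn G S x y) (i : Fin (length w)) →
    Joins G (edgeAt w i) (vertexAt w (inject₁ i)) (vertexAt w (suc i))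
  edgeAt-joins (step f _ j w) zero = subst (Joins G f _) (sym (vertexAt-first w)) j
  edgeAt-joins (step _ _ _ w) (suc i) = edgeAt-joins w i

  data IsPath {S : Subset m} : Conn G S x y → Set where
    here : IsPath (here {x = x})
    step : ∀ {f f∈S} {j : Joins G f x y} {w : Conn G S y z} →
           (∀ i → vertexAt w i ≢ x) → IsPath w → IsPath (step f f∈S j w)

  IsPath⇒vertexAt-injective : {w : Conn G S x y} → IsPath w → Injective _≡_ _≡_ (vertexAt w)
  IsPath⇒vertexAt-injective here {zero} {zero} _ = refl
  IsPath⇒vertexAt-injective (step _ _) {zero} {zero} _ = refl
  IsPath⇒vertexAt-injective (step x∉w _) {zero} {suc j} eq = ⊥-elim (x∉w j (sym eq))
  IsPath⇒vertexAt-injective (step x∉w _) {suc i} {zero} eq = ⊥-elim (x∉w i eq)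
  IsPath⇒vertexAt-injective (step _ p) {suc i} {suc j} eq =
    cong suc (IsPath⇒vertexAt-injective p eq)

  private
    vertex-fresh⇒edge-fresh : {w : Conn G S y z} → (∀ i → vertexAt w i ≢ x) →
      Joins G f x y → ∀ i → edgeAt w i ≢ f
    vertex-fresh⇒edge-fresh {w = w} x∉w j i refl =
      [ x∉w (inject₁ i) ∘ sym , x∉w (suc i) ∘ sym ]′ (Joins-endpoint j (edgeAt-joins w i))

  IsPath⇒edgeAt-injective : {w : Conn G S x y} → IsPath w → Injective _≡_ _≡_ (edgeAt w)
  IsPath⇒edgeAt-injective (step _ _) {zero} {zero} _ = refl
  IsPath⇒edgeAt-injective {w = step _ _ j _} (step x∉w _) {zero} {suc i} eq =
    ⊥-elim (vertex-fresh⇒edge-fresh x∉w j i (sym eq))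
  IsPath⇒edgeAt-injective {w = step _ _ j _} (step x∉w _) {suc i} {zero} eq =
    ⊥-elim (vertex-fresh⇒edge-fresh x∉w j i eq)
  IsPath⇒edgeAt-injective (step _ p) {suc i} {suc j} eq =
    cong suc (IsPath⇒edgeAt-injective p eq)

  IsPath⇒length< : {w : Conn G S x y} → IsPath w → length w < n
  IsPath⇒length< p = injective⇒≤ (IsPath⇒vertexAt-injective p)

  dropPath : (w : Conn G S x y) (i : Fin (suc (length w))) → IsPath w →
    Σ (Conn G S (vertexAt w i) y) IsPath
  dropPath here zero p = here , p
  dropPath w@(step _ _ _ _) zero p = w , p
  dropPath (step _ _ _ w) (suc i) (step _ p) = dropPath w i p

  toPath : Conn G S x y → Σ (Conn G S x y) IsPath
  toPath here = here , here
  toPath {S = S} {x = x} {y = y} (step f f∈S j w) with toPath w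
  ... | w′ , p with any? (λ i → vertexAt w′ i ≟ x)
  ...   | yes (i , refl) = dropPath w′ i p
  ...   | no x∉w′ = step f f∈S j w′ , step (λ i eq → x∉w′ (i , eq)) p

  Joins? : ∀ f x y → Dec (Joins G f x y)
  Joins? f x y = ≡-dec _≟_ _≟_ (ends f) (x , y) ⊎-dec ≡-dec _≟_ _≟_ (ends f) (y , x)

  Conn≤ : Subset m → ℕ → Fin n → Fin n → Set
  Conn≤ S k x y = Σ (Conn G S x y) λ w → length w ≤ k

  Conn≤? : ∀ S k x y → Dec (Conn≤ S k x y)
  Conn≤? S k x y with x ≟ y
  ... | yes refl = yes (here , z≤n)
  Conn≤? S zero x y | no x≢y = no λ { (here , _) → x≢y refl }
  Conn≤? S (suc k) x y | no x≢y
    with any? (λ f → f ∈? S ×-dec any? (λ z → Joins? f x z ×-dec Conn≤? S k z y))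
  ... | yes (f , f∈S , z , j , w , len≤k) = yes (step f f∈S j w , s≤s len≤k)
  ... | no ¬first-step = no λ
    { (here , _) → x≢y refl
    ; (step f f∈S j w , s≤s len≤k) → ¬first-step (f , f∈S , _ , j , w , len≤k) }

  Conn? : ∀ S x y → Dec (Conn G S x y)
  Conn? S x y = map′ proj₁ shorten (Conn≤? S n x y)
    where
    shorten : Conn G S x y → Conn≤ S n x y
    shorten w with toPath w
    ... | w′ , p = w′ , <⇒≤ (IsPath⇒length< p)

module Cycles (G : Graph) where
  open Graph G
  open Walks G

  module _ (W : Cycle G) where
    open Cycle W

    private
      vert? : ∀ x → Dec (∃[ i ] vert i ≡ x)
      vert? x = any? λ i → vert i ≟ x

      edge? : ∀ f → Dec (∃[ i ] edge i ≡ f)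
      edge? f = any? λ i → edge i ≟ f

      closed′ : ∀ f x → f ∈ tabulate (does ∘ edge?) → EndOf G x f → x ∈ tabulate (does ∘ vert?)
      closed′ f x f∈ x∈f with tabulate-∈⁻ edge? f∈
      ... | i , refl = tabulate-∈⁺ vert?
        ([ (λ x≡ → inject₁ i , sym x≡) , (λ x≡ → suc i , sym x≡) ]′ (EndOf-Joins x∈f (incident i)))

    body : Subgraph G
    body = sub (tabulate (does ∘ vert?)) (tabulate (does ∘ edge?)) closed′

    body-isBodyOf : IsBodyOf G body W
    body-isBodyOf = (λ x → mk⇔ (tabulate-∈⁻ vert?) (tabulate-∈⁺ vert?))
                  , (λ f → mk⇔ (tabulate-∈⁻ edge?) (tabulate-∈⁺ edge?))

  module _ {S e x y} (e∉S : e ∉ S) (e-joins : Joins G e x y)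
           (w : Conn G S y x) (w-isPath : IsPath w) where

    private
      vert : Fin (suc (suc (length w))) → Fin n
      vert zero = x
      vert (suc i) = vertexAt w i

      edge : Fin (suc (length w)) → Fin m
      edge zero = e
      edge (suc i) = edgeAt w i

      incident : ∀ i → Joins G (edge i) (vert (inject₁ i)) (vert (suc i))
      incident zero = subst (Joins G e x) (sym (vertexAt-first w)) e-joins
      incident (suc i) = edgeAt-joins w i

      e∉w : ∀ i → e ≢ edgeAt w i
      e∉w i e≡ = e∉S (subst (_∈ S) (sym e≡) (edgeAt-∈ w i))

      edgeInj : Injective _≡_ _≡_ edge
      edgeInj {zero} {zero} _ = refl
      edgeInj {zero} {suc j} eq = ⊥-elim (e∉w j eq)
      edgeInj {suc i} {zero} eq = ⊥-elim (e∉w i (sym eq))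
      edgeInj {suc i} {suc j} eq = cong suc (IsPath⇒edgeAt-injective w-isPath eq)

      x-last : ∀ {i} → x ≡ vertexAt w (inject₁ i) → ⊥
      x-last eq = fromℕ≢inject₁
        (IsPath⇒vertexAt-injective w-isPath (trans (vertexAt-last w) eq))

      vertInj : Injective _≡_ _≡_ (vert ∘ inject₁)
      vertInj {zero} {zero} _ = refl
      vertInj {zero} {suc j} eq = ⊥-elim (x-last eq)
      vertInj {suc i} {zero} eq = ⊥-elim (x-last (sym eq))
      vertInj {suc i} {suc j} eq =
        cong suc (inject₁-injective (IsPath⇒vertexAt-injective w-isPath eq))

    closePath : Cycle G
    closePath = record
      { len = suc (length w) ; len≥1 = s≤s z≤n ; vert = vert ; edge = edge
      ; incident = incident ; isClosed = sym (vertexAt-last w)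
      ; edgeInj = edgeInj ; vertInj = vertInj }

  Bridgeless⇒edge-on-cycle : Bridgeless G → ∀ e → ∃[ C ] IsCycleBody G C × e ∈ edges C
  Bridgeless⇒edge-on-cycle bridgeless e
    with toPath (bridgeless e ∈⊤ _ _ tt tt (step e ∈⊤ (inj₂ refl) here))
  ... | w , w-isPath =
    body W , (W , body-isBodyOf W) , Equivalence.from (proj₂ (body-isBodyOf W) e) (zero , refl)
    where
    W : Cycle G
    W = closePath (λ e∈S → x∈p─q⇒x∉q ⊤ ⁅ e ⁆ e∈S (x∈⁅x⁆ e)) (inj₁ refl) w w-isPath

  module _ (s : Fin n → Bool) where

    crosses : Fin m → Bool
    crosses f = s (proj₁ (ends f)) xor s (proj₂ (ends f))

    crosses-Joins : ∀ {f x y} → Joins G f x y → crosses f ≡ s x xor s y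
    crosses-Joins (inj₁ refl) = refl
    crosses-Joins {x = x} {y} (inj₂ refl) = xor-comm (s y) (s x)

    cycle-crossings-even : ∀ C → IsCycleBody G C →
      ∑[ f < m ] (f ∈ᵇ edges C ∧ crosses f) ≡ false
    cycle-crossings-even C (W , _ , C-edges) = begin
      ∑[ f < m ] (f ∈ᵇ edges C ∧ crosses f)
        ≡⟨ sum-cong-≗ (λ f → cong (_∧ crosses f) (does-⇔ (C-edges f) (f ∈? edges C) (edge? f))) ⟩
      ∑[ f < m ] (does (any? λ i → edge i ≟ f) ∧ crosses f)
        ≡⟨ ∑-image edgeInj crosses ⟩
      ∑[ i < len ] crosses (edge i)
        ≡⟨ sum-cong-≗ (λ i → crosses-Joins (incident i)) ⟩
      ∑[ i < len ] (s (vert (inject₁ i)) xor s (vert (suc i)))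
        ≡⟨ ∑-telescope (s ∘ vert) ⟩
      s (vert zero) xor s (vert (fromℕ len))
        ≡⟨ cong (λ x → s x xor s (vert (fromℕ len))) isClosed ⟩
      s (vert (fromℕ len)) xor s (vert (fromℕ len))
        ≡⟨ xor-same (s (vert (fromℕ len))) ⟩
      false ∎
      where
      open Cycle W
      edge? : ∀ f → Dec (∃[ i ] edge i ≡ f)
      edge? f = any? λ i → edge i ≟ f
      open ≡-Reasoning

module Subgraphs (G : Graph) where
  open Graph G

  infixl 6 _+ₑ_
  _+ₑ_ : Subgraph G → Fin m → Subgraph G
  K +ₑ e = sub (verts K ∪ (⁅ proj₁ (ends e) ⁆ ∪ ⁅ proj₂ (ends e) ⁆)) (edges K ∪ ⁅ e ⁆) closed′
    where
    closed′ : ∀ f x → f ∈ edges K ∪ ⁅ e ⁆ → EndOf G x f →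
              x ∈ verts K ∪ (⁅ proj₁ (ends e) ⁆ ∪ ⁅ proj₂ (ends e) ⁆)
    closed′ f x f∈ x∈f with x∈p∪q⁻ (edges K) ⁅ e ⁆ f∈
    ... | inj₁ f∈K = x∈p∪q⁺ (inj₁ (closed K f x f∈K x∈f))
    ... | inj₂ f∈⁅e⁆ with x∈⁅y⁆⇒x≡y e f∈⁅e⁆ | x∈f
    ...   | refl | inj₁ refl = x∈p∪q⁺ (inj₂ (x∈p∪q⁺ (inj₁ (x∈⁅x⁆ _))))
    ...   | refl | inj₂ refl = x∈p∪q⁺ (inj₂ (x∈p∪q⁺ (inj₂ (x∈⁅x⁆ _))))

  ⊑-+ₑ : ∀ K e → _⊑_ G K (K +ₑ e)
  ⊑-+ₑ K e = x∈p∪q⁺ ∘ inj₁ , x∈p∪q⁺ ∘ inj₁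

  ∈-+ₑ : ∀ K e → e ∈ edges (K +ₑ e)
  ∈-+ₑ K e = x∈p∪q⁺ (inj₂ (x∈⁅x⁆ e))

  +ₑ-⊑ : ∀ {K C e} → _⊑_ G K C → e ∈ edges C → _⊑_ G (K +ₑ e) C
  +ₑ-⊑ {K} {C} {e} (K⊆C , K⊆Cₑ) e∈C = verts⊆ , edges⊆
    where
    verts⊆ : ∀ {x} → x ∈ verts (K +ₑ e) → x ∈ verts C
    verts⊆ x∈ with x∈p∪q⁻ (verts K) _ x∈
    ... | inj₁ x∈K = K⊆C x∈K
    ... | inj₂ x∈ends with x∈p∪q⁻ ⁅ _ ⁆ ⁅ _ ⁆ x∈ends
    ...   | inj₁ x∈⁅u⁆ = closed C e _ e∈C (inj₁ (sym (x∈⁅y⁆⇒x≡y _ x∈⁅u⁆)))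
    ...   | inj₂ x∈⁅v⁆ = closed C e _ e∈C (inj₂ (sym (x∈⁅y⁆⇒x≡y _ x∈⁅v⁆)))

    edges⊆ : ∀ {f} → f ∈ edges (K +ₑ e) → f ∈ edges C
    edges⊆ f∈ with x∈p∪q⁻ (edges K) ⁅ e ⁆ f∈
    ... | inj₁ f∈K = K⊆Cₑ f∈K
    ... | inj₂ f∈⁅e⁆ = subst (_∈ edges C) (sym (x∈⁅y⁆⇒x≡y e f∈⁅e⁆)) e∈C

module CycleSegment (G : Graph) (bridgeless : Bridgeless G)
  (H : Subgraph G) (H-segment : IsCycleSegment G H) (e : Fin (Graph.m G)) (e∉H : e ∉ edges H)
  where
  open Graph G
  open Walks G
  open Cycles G
  open Subgraphs G

  S : Subset m
  S = ∁ (edges H) ─ ⁅ e ⁆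

  u v : Fin n
  u = proj₁ (ends e)
  v = proj₂ (ends e)

  module _ (u↮v : ¬ Conn G S u v) where

    reachable : Fin n → Bool
    reachable x = does (Conn? S u x)

    crosses-e : crosses reachable e ≡ true
    crosses-e = cong₂ _xor_ (dec-true (Conn? S u u) here) (dec-false (Conn? S u v) u↮v)

    crosses-S : ∀ {f} → f ∈ S → crosses reachable f ≡ false
    crosses-S {f} f∈S =
      trans (cong (_xor reachable (proj₂ (ends f))) (does-⇔ extend (Conn? S u _) (Conn? S u _)))
            (xor-same (reachable (proj₂ (ends f))))
      where
      extend : Conn G S u (proj₁ (ends f)) ⇔ Conn G S u (proj₂ (ends f))
      extend = mk⇔ (_◅◅ step f f∈S (inj₁ refl) here) (_◅◅ step f f∈S (inj₂ refl) here)

    H-crossing : Fin m → Bool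
    H-crossing f = f ∈ᵇ edges H ∧ crosses reachable f

    crossings-in-H-or-e : ∀ (C : Subgraph G) f → f ∈ᵇ edges C ∧ crosses reachable f ≡
      (f ∈ᵇ edges C ∧ H-crossing f) xor (does (e ≟ f) ∧ f ∈ᵇ edges C)
    crossings-in-H-or-e C f with f ∈? edges C | f ∈? edges H | e ≟ f
    ... | _       | yes f∈H | yes refl = ⊥-elim (e∉H f∈H)
    ... | no _    | _       | yes _    = refl
    ... | no _    | _       | no _     = refl
    ... | yes _   | yes _   | no _     = sym (xor-identityʳ (crosses reachable f))
    ... | yes _   | no _    | yes refl = crosses-e
    ... | yes _   | no f∉H  | no e≢f   = crosses-S (x∈p∧x≢y⇒x∈p-y (x∉p⇒x∈∁p f∉H) (e≢f ∘ sym))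

    e-parity : ∀ C → IsCycleBody G C → e ∈ᵇ edges C ≡ ∑[ f < m ] (f ∈ᵇ edges C ∧ H-crossing f)
    e-parity C C-cycle = sym (xor≡false⇒≡ (begin
      ∑[ f < m ] CH-crossing f xor e ∈ᵇ edges C
        ≡⟨ cong (∑[ f < m ] CH-crossing f xor_) (∑-δ e (_∈ᵇ edges C)) ⟨
      ∑[ f < m ] CH-crossing f xor ∑[ f < m ] (does (e ≟ f) ∧ f ∈ᵇ edges C)
        ≡⟨ ∑-distrib-+ CH-crossing (λ f → does (e ≟ f) ∧ f ∈ᵇ edges C) ⟨
      ∑[ f < m ] (CH-crossing f xor (does (e ≟ f) ∧ f ∈ᵇ edges C))
        ≡⟨ sum-cong-≗ (crossings-in-H-or-e C) ⟨
      ∑[ f < m ] (f ∈ᵇ edges C ∧ crosses reachable f)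
        ≡⟨ cycle-crossings-even reachable C C-cycle ⟩
      false ∎))
      where
      CH-crossing : Fin m → Bool
      CH-crossing f = f ∈ᵇ edges C ∧ H-crossing f
      open ≡-Reasoning

    cycle-through-e-meets-H : ∀ C → IsCycleBody G C → e ∈ edges C → ∃[ f ] f ∈ edges H × f ∈ edges C
    cycle-through-e-meets-H C C-cycle e∈C
      with ∑≡true⇒∃ _ (trans (sym (e-parity C C-cycle)) (dec-true (e ∈? edges C) e∈C))
    ... | f , term≡true with f ∈? edges C | f ∈? edges H
    ...   | yes f∈C | yes f∈H = f , f∈H , f∈C

    cycle-through-e-contains-H : ∀ C → IsCycleBody G C → e ∈ edges C → _⊑_ G H C
    cycle-through-e-contains-H C C-cycle e∈C =
      proj₁ H-segment C C-cycle (cycle-through-e-meets-H C C-cycle e∈C)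

    e-parity-over-H : ∀ C → IsCycleBody G C → _⊑_ G H C → e ∈ᵇ edges C ≡ ∑[ f < m ] H-crossing f
    e-parity-over-H C C-cycle (_ , H⊆C) = trans (e-parity C C-cycle) (sum-cong-≗ restrict)
      where
      restrict : ∀ f → f ∈ᵇ edges C ∧ H-crossing f ≡ H-crossing f
      restrict f with f ∈? edges H
      ... | yes f∈H rewrite dec-true (f ∈? edges C) (H⊆C f∈H) = refl
      ... | no _ = ∧-zeroʳ (f ∈ᵇ edges C)

    cycle-containing-H-contains-e : ∀ C → IsCycleBody G C → _⊑_ G H C → e ∈ edges C
    cycle-containing-H-contains-e C C-cycle H⊑C with Bridgeless⇒edge-on-cycle bridgeless e
    ... | C′ , C′-cycle , e∈C′ = ∈ᵇ⇒∈ (begin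
      e ∈ᵇ edges C           ≡⟨ e-parity-over-H C C-cycle H⊑C ⟩
      ∑[ f < m ] H-crossing f ≡⟨ e-parity-over-H C′ C′-cycle H⊑C′ ⟨
      e ∈ᵇ edges C′          ≡⟨ dec-true (e ∈? edges C′) e∈C′ ⟩
      true                   ∎)
      where
      H⊑C′ : _⊑_ G H C′
      H⊑C′ = cycle-through-e-contains-H C′ C′-cycle e∈C′
      open ≡-Reasoning

    H+e-segment : SegProp G (H +ₑ e)
    H+e-segment C C-cycle (f , f∈H+e , f∈C) =
      +ₑ-⊑ {H} {C} {e} H⊑C (cycle-containing-H-contains-e C C-cycle H⊑C)
      where
      H⊑C : _⊑_ G H C
      H⊑C with x∈p∪q⁻ (edges H) ⁅ e ⁆ f∈H+e
      ... | inj₁ f∈H = proj₁ H-segment C C-cycle (f , f∈H , f∈C)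
      ... | inj₂ f∈⁅e⁆ = cycle-through-e-contains-H C C-cycle
                            (subst (_∈ edges C) (x∈⁅y⁆⇒x≡y e f∈⁅e⁆) f∈C)

    H+e-violates-maximality : ⊥
    H+e-violates-maximality =
      e∉H (proj₂ (proj₂ H-segment (H +ₑ e) H+e-segment (⊑-+ₑ H e)) (∈-+ₑ H e))

  ends-connected : Conn G S u v
  ends-connected with Conn? S u v
  ... | yes u↔v = u↔v
  ... | no u↮v = ⊥-elim (H+e-violates-maximality u↮v)

  bypass : ∀ {x y} → Conn G (∁ (edges H)) x y → Conn G S x y
  bypass here = here
  bypass (step f f∈G−H j w) with f ≟ e
  ... | yes refl = along-e j ◅◅ bypass w
    where
    along-e : ∀ {x y} → Joins G e x y → Conn G S x y
    along-e (inj₁ refl) = ends-connected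
    along-e (inj₂ refl) = reverse ends-connected
  ... | no f≢e = step f (x∈p∧x≢y⇒x∈p-y f∈G−H f≢e) j (bypass w)

proposition3p2 : (G : Graph) → Connected G → Bridgeless G → CDim≥2 G →
    (H : Subgraph G) → IsCycleSegment G H → BridgelessMinus G H
proposition3p2 G _ bridgeless _ H H-segment e e∈G−H x y _ _ w =
  CycleSegment.bypass G bridgeless H H-segment e (x∈∁p⇒x∉p e∈G−H) w
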